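{- Every graph homomorphism from $\mathcal{PC}_6$ to $\mathcal{PC}_4$ is surjective (onto the vertex set of $\mathcal{PC}_4$).
   Context: The projective cube of dimension $d$, $\mathcal{PC}_d$, is the Cayley graph on $\mathbb{Z}_2^d$ with $u\sim v$ iff $u-v\in\{e_1,\dots,e_d,J\}$, where $e_1,\dots,e_d$ is the canonical basis and $J$ the all-ones vector. A homomorphism is a map of vertex sets sending edges to edges. -}

module Defs where

open import Data.Nat using (ℕ)
open import Data.Bool using (Bool; true; false; not; _xor_)
open import Data.Fin using (Fin)
open import Data.Vec using (Vec; zipWith; replicate; updateAt; lookup; tabulate)
open import Data.Product using (∃-syntax)
open import Data.Sum using (_⊎_)
open import Relation.Binary.PropositionalEquality using (_≡_)

-- Vertices of the projective cube PC_d: elements of Z_2^d, as Bool vectors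
-- (addition in Z_2 is xor).
Vertex : ℕ → Set
Vertex d = Vec Bool d

_⊕_ : ∀ {d} → Vertex d → Vertex d → Vertex d
u ⊕ v = zipWith _xor_ u v

e : ∀ {d} → Fin d → Vertex d
e i = tabulate (λ j → isEq i j)
  where
  open import Data.Fin using (_≟_)
  open import Relation.Nullary using (does)
  isEq : ∀ {d} → Fin d → Fin d → Bool
  isEq i j = does (i ≟ j)

J : ∀ {d} → Vertex d
J = replicate _ true

InGen : ∀ {d} → Vertex d → Set
InGen {d} s = (∃[ i ] s ≡ e i) ⊎ s ≡ J

-- Adjacency in PC_d: u ~ v iff u - v ∈ S (in Z_2^d, u - v = u + v).
Adj : ∀ {d} → Vertex d → Vertex d → Set
Adj u v = InGen (u ⊕ v)

IsHom : ∀ {m n} → (Vertex m → Vertex n) → Set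
IsHom {m} f = ∀ (u v : Vertex m) → Adj u v → Adj (f u) (f v)

Surjective : ∀ {m n} → (Vertex m → Vertex n) → Set
Surjective {m} {n} f = ∀ (w : Vertex n) → ∃[ u ] f u ≡ w

module Submission where

-- Translations x ↦ x ⊕ w are automorphisms of PC₄, so it suffices to show that no
-- homomorphism g : PC₆ → PC₄ avoids the origin 0.  Suppose g does.
--   * If g never takes a value adjacent to 0 (a generator), then g maps PC₆ into the
--     Petersen graph PC₄ minus the closed neighbourhood of 0, which a finite search refutes.
--   * Otherwise g u is a generator for some u.  Translating the domain and permuting the
--     five generators of PC₄ we may assume g 0 = J.  The seven neighbours of 0 are then
--     sent to the four neighbours of J other than 0, giving a labelling n : Fin 4 ^ 7.
--     Permuting the seven generators of PC₆ and the four remaining generators of PC₄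
--     turns n into one of 11 canonical patterns (partitions of 7 into at most four
--     parts), and a finite search refutes each of them.
-- Generator permutations act through linear maps ('relabel'); such a map is a graph
-- homomorphism once it sends J to the right generator ('Consistent'), and it only sends
-- 0 to 0 when it has a relabelling inverse ('TargetSymmetry').  The finite searches run
-- a verified arc-consistency propagation with branching ('Refutation'): a run that
-- returns true proves that no homomorphism takes its values in the initial candidate sets.

open import Defs
open import Data.Nat using (ℕ; zero; suc; _+_; _<ᵇ_; _≡ᵇ_; _^_)
open import Data.Bool using (Bool; true; false; _∧_; _∨_; not; _xor_; T; if_then_else_)
open import Data.Bool.Properties using (xor-assoc; xor-comm; xor-identityˡ; xor-same; T-∧; T-∨; T-≡; ∧-conicalˡ; ∧-conicalʳ)
import Data.Bool.Properties as Bool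
open import Data.Bool.ListAction using (all)
open import Data.Fin using (Fin; zero; suc; #_; toℕ; lift)
open import Data.Fin.Properties using (all?; any?) renaming (_≟_ to _≟ᶠ_)
open import Data.Fin.Permutation.Components using (transpose)
open import Data.Vec using (Vec; []; _∷_; replicate; tabulate; lookup; map; _++_; count)
open import Data.Vec.Properties using (zipWith-assoc; zipWith-comm; zipWith-identityˡ; lookup∘tabulate; tabulate-∘; tabulate-cong; ≡-dec)
open import Data.List using (List; []; _∷_; allFin; cartesianProductWith; foldr; foldl; length; filterᵇ; concatMap)
import Data.List as List
open import Data.List.Membership.Propositional using (_∈_; lose)
open import Data.List.Membership.Propositional.Properties using (∈-map⁺; ∈-map⁻; ∈-allFin; ∈-cartesianProductWith⁺)
open import Data.List.Membership.DecPropositional (≡-dec {n = 7} (_≟ᶠ_ {4})) using (_∈?_)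
open import Data.List.Relation.Unary.Any using (here; there)
import Data.List.Relation.Unary.Any as Any
open import Data.List.Relation.Unary.All using (All; []; _∷_)
import Data.List.Relation.Unary.All as All
open import Data.Maybe using (Maybe; just; nothing; _>>=_)
open import Data.Product using (_×_; _,_; ∃; ∃-syntax; proj₁; proj₂)
open import Data.Sum using (_⊎_; inj₁; inj₂)
open import Data.Empty using (⊥; ⊥-elim)
open import Data.Unit using (tt)
open import Function using (_∘_)
open import Function.Bundles using (Equivalence)
open import Relation.Nullary using (¬_; Dec; yes; no; _×-dec_)
import Relation.Nullary.Decidable as Dec
open import Relation.Nullary.Decidable using (toWitness; ⌊_⌋)
open import Relation.Unary using (Decidable)
open import Relation.Binary.Definitions using (DecidableEquality)
open import Relation.Binary.PropositionalEquality using (_≡_; _≢_; refl; sym; trans; cong; cong₂; subst; module ≡-Reasoning)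

origin : ∀ {d} → Vertex d
origin = replicate _ false

⊕-assoc : ∀ {d} (u v w : Vertex d) → (u ⊕ v) ⊕ w ≡ u ⊕ (v ⊕ w)
⊕-assoc = zipWith-assoc xor-assoc

⊕-comm : ∀ {d} (u v : Vertex d) → u ⊕ v ≡ v ⊕ u
⊕-comm = zipWith-comm xor-comm

⊕-identityˡ : ∀ {d} (u : Vertex d) → origin ⊕ u ≡ u
⊕-identityˡ = zipWith-identityˡ xor-identityˡ

⊕-identityʳ : ∀ {d} (u : Vertex d) → u ⊕ origin ≡ u
⊕-identityʳ u = trans (⊕-comm u origin) (⊕-identityˡ u)

⊕-self : ∀ {d} (u : Vertex d) → u ⊕ u ≡ origin
⊕-self []      = refl
⊕-self (a ∷ u) = cong₂ _∷_ (xor-same a) (⊕-self u)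

⊕-cancelˡ : ∀ {d} (u v : Vertex d) → u ⊕ (u ⊕ v) ≡ v
⊕-cancelˡ u v = begin
  u ⊕ (u ⊕ v)  ≡⟨ sym (⊕-assoc u u v) ⟩
  (u ⊕ u) ⊕ v  ≡⟨ cong (_⊕ v) (⊕-self u) ⟩
  origin ⊕ v   ≡⟨ ⊕-identityˡ v ⟩
  v            ∎
  where open ≡-Reasoning

⊕-interchange : ∀ {d} (a b c w : Vertex d) → (a ⊕ b) ⊕ (c ⊕ w) ≡ (a ⊕ c) ⊕ (b ⊕ w)
⊕-interchange a b c w = begin
  (a ⊕ b) ⊕ (c ⊕ w)  ≡⟨ ⊕-assoc a b (c ⊕ w) ⟩
  a ⊕ (b ⊕ (c ⊕ w))  ≡⟨ cong (a ⊕_) (sym (⊕-assoc b c w)) ⟩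
  a ⊕ ((b ⊕ c) ⊕ w)  ≡⟨ cong (λ t → a ⊕ (t ⊕ w)) (⊕-comm b c) ⟩
  a ⊕ ((c ⊕ b) ⊕ w)  ≡⟨ cong (a ⊕_) (⊕-assoc c b w) ⟩
  a ⊕ (c ⊕ (b ⊕ w))  ≡⟨ sym (⊕-assoc a c (b ⊕ w)) ⟩
  (a ⊕ c) ⊕ (b ⊕ w)  ∎
  where open ≡-Reasoning

-- Translating both endpoints does not change their difference; hence translations
-- are graph automorphisms.
⊕-translate : ∀ {d} (u v c : Vertex d) → (u ⊕ c) ⊕ (v ⊕ c) ≡ u ⊕ v
⊕-translate u v c = begin
  (u ⊕ c) ⊕ (v ⊕ c)  ≡⟨ ⊕-interchange u c v c ⟩
  (u ⊕ v) ⊕ (c ⊕ c)  ≡⟨ cong ((u ⊕ v) ⊕_) (⊕-self c) ⟩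
  (u ⊕ v) ⊕ origin   ≡⟨ ⊕-identityʳ (u ⊕ v) ⟩
  u ⊕ v              ∎
  where open ≡-Reasoning

⊕-equal : ∀ {d} (u v : Vertex d) → u ⊕ v ≡ origin → u ≡ v
⊕-equal u v u⊕v≡0 = begin
  u            ≡⟨ sym (⊕-identityʳ u) ⟩
  u ⊕ origin   ≡⟨ cong (u ⊕_) (sym (⊕-self v)) ⟩
  u ⊕ (v ⊕ v)  ≡⟨ sym (⊕-assoc u v v) ⟩
  (u ⊕ v) ⊕ v  ≡⟨ cong (_⊕ v) u⊕v≡0 ⟩
  origin ⊕ v   ≡⟨ ⊕-identityˡ v ⟩
  v            ∎
  where open ≡-Reasoning

infix 4 _≟ᵥ_
_≟ᵥ_ : ∀ {d} → DecidableEquality (Vertex d)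
_≟ᵥ_ = ≡-dec Bool._≟_

gen : ∀ {d} → Fin (suc d) → Vertex d
gen zero    = J
gen (suc i) = e i

InGen⇒gen : ∀ {d} {s : Vertex d} → InGen s → ∃[ i ] s ≡ gen i
InGen⇒gen (inj₁ (i , s≡eᵢ)) = suc i , s≡eᵢ
InGen⇒gen (inj₂ s≡J)        = zero , s≡J

gen-InGen : ∀ {d} (i : Fin (suc d)) → InGen (gen i)
gen-InGen zero    = inj₂ refl
gen-InGen (suc i) = inj₁ (i , refl)

InGen? : ∀ {d} → Decidable (InGen {d})
InGen? s = Dec.map′ (λ (i , s≡gᵢ) → subst InGen (sym s≡gᵢ) (gen-InGen i)) InGen⇒gen (any? λ i → s ≟ᵥ gen i)

generators : ∀ d → List (Vertex d)
generators d = List.map gen (allFin (suc d))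

∈-generators : ∀ {d} {s : Vertex d} → InGen s → s ∈ generators d
∈-generators s∈S with InGen⇒gen s∈S
... | i , refl = ∈-map⁺ gen (∈-allFin i)

generators-InGen : ∀ {d} {s : Vertex d} → s ∈ generators d → InGen s
generators-InGen {d} s∈gens =
  let (i , _ , s≡gᵢ) = ∈-map⁻ gen {xs = allFin (suc d)} s∈gens in subst InGen (sym s≡gᵢ) (gen-InGen {d} i)

Adj-step : ∀ {d} (v : Vertex d) {s : Vertex d} → InGen s → Adj v (v ⊕ s)
Adj-step v {s} s∈S = subst InGen (sym (⊕-cancelˡ v s)) s∈S

Adj⇒gen : ∀ {d} {v u : Vertex d} → Adj v u → ∃[ i ] u ≡ v ⊕ gen i
Adj⇒gen {v = v} {u} v~u with InGen⇒gen v~u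
... | i , v⊕u≡gᵢ = i , trans (sym (⊕-cancelˡ v u)) (cong (v ⊕_) v⊕u≡gᵢ)

translation-hom : ∀ {d} (c : Vertex d) → IsHom (λ x → x ⊕ c)
translation-hom c u v u~v = subst InGen (sym (⊕-translate u v c)) u~v

∘-hom : ∀ {l m n} {f : Vertex l → Vertex m} {g : Vertex m → Vertex n} →
        IsHom f → IsHom g → IsHom (g ∘ f)
∘-hom f-hom g-hom u v u~v = g-hom _ _ (f-hom u v u~v)

Avoids : ∀ {m n} → (Vertex m → Vertex n) → Set
Avoids g = ∀ x → g x ≢ origin

vectors : ∀ {A : Set} → List A → ∀ l → List (Vec A l)
vectors as zero    = [] ∷ []
vectors as (suc l) = cartesianProductWith _∷_ as (vectors as l)

∈-vectors : ∀ {A : Set} {as : List A} → (∀ a → a ∈ as) → ∀ {l} (v : Vec A l) → v ∈ vectors as l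
∈-vectors complete []      = here refl
∈-vectors complete (a ∷ v) = ∈-cartesianProductWith⁺ _∷_ (complete a) (∈-vectors complete v)

vertices : ∀ n → List (Vertex n)
vertices = vectors (false ∷ true ∷ [])

∈-vertices : ∀ {n} (x : Vertex n) → x ∈ vertices n
∈-vertices = ∈-vectors λ { false → here refl ; true → there (here refl) }

witnessOrNone : ∀ {n} {P : Vertex n → Set} → Decidable P → ∃ P ⊎ (∀ x → ¬ P x)
witnessOrNone {n} P? with Any.any? P? (vertices n)
... | yes witness = inj₁ (Any.satisfied witness)
... | no  none    = inj₂ λ x Px → none (lose (∈-vertices x) Px)

all-sound : ∀ {A : Set} (p : A → Bool) {xs : List A} {x} → all p xs ≡ true → x ∈ xs → p x ≡ true
all-sound p {y ∷ ys} holds (here refl)  = ∧-conicalˡ (p y) (all p ys) holds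
all-sound p {y ∷ ys} holds (there x∈ys) = all-sound p (∧-conicalʳ (p y) (all p ys) holds) x∈ys

_·_ : ∀ {d} → Bool → Vertex d → Vertex d
true  · v = v
false · v = origin

·-xor : ∀ {d} a b (v : Vertex d) → (a xor b) · v ≡ (a · v) ⊕ (b · v)
·-xor false false v = sym (⊕-identityˡ origin)
·-xor false true  v = sym (⊕-identityˡ v)
·-xor true  false v = sym (⊕-identityʳ v)
·-xor true  true  v = sym (⊕-self v)

-- The basis vector e zero is true ∷ tabulate (λ _ → false), whose tail is the origin.
tabulate-false : ∀ {k} → tabulate {k} (λ _ → false) ≡ origin
tabulate-false {zero}  = refl
tabulate-false {suc k} = cong (false ∷_) tabulate-false

linear : ∀ {m n} → Vec (Vertex n) m → Vertex m → Vertex n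
linear []       []      = origin
linear (c ∷ cs) (a ∷ x) = (a · c) ⊕ linear cs x

linear-⊕ : ∀ {m n} (cs : Vec (Vertex n) m) (u v : Vertex m) →
           linear cs (u ⊕ v) ≡ linear cs u ⊕ linear cs v
linear-⊕ []       []      []      = sym (⊕-self origin)
linear-⊕ (c ∷ cs) (a ∷ u) (b ∷ v) = begin
  ((a xor b) · c) ⊕ linear cs (u ⊕ v)                ≡⟨ cong₂ _⊕_ (·-xor a b c) (linear-⊕ cs u v) ⟩
  ((a · c) ⊕ (b · c)) ⊕ (linear cs u ⊕ linear cs v)  ≡⟨ ⊕-interchange (a · c) (b · c) (linear cs u) (linear cs v) ⟩
  ((a · c) ⊕ linear cs u) ⊕ ((b · c) ⊕ linear cs v)  ∎
  where open ≡-Reasoning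

linear-origin : ∀ {m n} (cs : Vec (Vertex n) m) → linear cs origin ≡ origin
linear-origin []       = refl
linear-origin (c ∷ cs) = trans (⊕-identityˡ _) (linear-origin cs)

linear-· : ∀ {m n} (ds : Vec (Vertex n) m) a (c : Vertex m) → linear ds (a · c) ≡ a · linear ds c
linear-· ds true  c = refl
linear-· ds false c = linear-origin ds

linear-e : ∀ {m n} (cs : Vec (Vertex n) m) (i : Fin m) → linear cs (e i) ≡ lookup cs i
linear-e (c ∷ cs) zero    =
  trans (cong (c ⊕_) (trans (cong (linear cs) tabulate-false) (linear-origin cs))) (⊕-identityʳ c)
linear-e (c ∷ cs) (suc i) = trans (⊕-identityˡ _) (linear-e cs i)

linear-compose : ∀ {l m n} (ds : Vec (Vertex n) m) (cs : Vec (Vertex m) l) (x : Vertex l) →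
                 linear ds (linear cs x) ≡ linear (map (linear ds) cs) x
linear-compose ds []       []      = linear-origin ds
linear-compose ds (c ∷ cs) (a ∷ x) = begin
  linear ds ((a · c) ⊕ linear cs x)                  ≡⟨ linear-⊕ ds (a · c) (linear cs x) ⟩
  linear ds (a · c) ⊕ linear ds (linear cs x)        ≡⟨ cong₂ _⊕_ (linear-· ds a c) (linear-compose ds cs x) ⟩
  (a · linear ds c) ⊕ linear (map (linear ds) cs) x  ∎
  where open ≡-Reasoning

linear-prefix : ∀ {m n} (cs : Vec (Vertex n) m) (x : Vertex m) →
                linear (map (false ∷_) cs) x ≡ false ∷ linear cs x
linear-prefix []       []          = refl
linear-prefix (c ∷ cs) (true ∷ x)  = cong ((false ∷ c) ⊕_) (linear-prefix cs x)
linear-prefix (c ∷ cs) (false ∷ x) = cong (origin ⊕_) (linear-prefix cs x)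

linear-basis : ∀ {d} (x : Vertex d) → linear (tabulate e) x ≡ x
linear-basis []      = refl
linear-basis (a ∷ x) = begin
  (a · e zero) ⊕ linear (tabulate (e ∘ suc)) x            ≡⟨ cong (λ cs → (a · e zero) ⊕ linear cs x) (tabulate-∘ (false ∷_) e) ⟩
  (a · e zero) ⊕ linear (map (false ∷_) (tabulate e)) x  ≡⟨ cong ((a · e zero) ⊕_) (linear-prefix (tabulate e) x) ⟩
  (a · e zero) ⊕ (false ∷ linear (tabulate e) x)         ≡⟨ cong (λ t → (a · e zero) ⊕ (false ∷ t)) (linear-basis x) ⟩
  (a · e zero) ⊕ (false ∷ x)                             ≡⟨ leading a ⟩
  a ∷ x                                                  ∎
  where
  open ≡-Reasoning
  leading : ∀ a → (a · e zero) ⊕ (false ∷ x) ≡ a ∷ x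
  leading true  = cong (true ∷_) (trans (cong (_⊕ x) tabulate-false) (⊕-identityˡ x))
  leading false = cong (false ∷_) (⊕-identityˡ x)

relabel : ∀ {d} → (Fin (suc d) → Fin (suc d)) → Vertex d → Vertex d
relabel π = linear (tabulate (gen ∘ π ∘ suc))

Consistent : ∀ {d} → (Fin (suc d) → Fin (suc d)) → Set
Consistent π = relabel π J ≡ gen (π zero)

consistent? : ∀ {d} (π : Fin (suc d) → Fin (suc d)) → Dec (Consistent π)
consistent? π = relabel π J ≟ᵥ gen (π zero)

relabel-⊕ : ∀ {d} (π : Fin (suc d) → Fin (suc d)) (u v : Vertex d) → relabel π (u ⊕ v) ≡ relabel π u ⊕ relabel π v
relabel-⊕ π = linear-⊕ (tabulate (gen ∘ π ∘ suc))

relabel-origin : ∀ {d} (π : Fin (suc d) → Fin (suc d)) → relabel π origin ≡ origin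
relabel-origin π = linear-origin (tabulate (gen ∘ π ∘ suc))

relabel-gen : ∀ {d} (π : Fin (suc d) → Fin (suc d)) → Consistent π → ∀ i → relabel π (gen i) ≡ gen (π i)
relabel-gen π consistent zero    = consistent
relabel-gen π consistent (suc i) =
  trans (linear-e (tabulate (gen ∘ π ∘ suc)) i) (lookup∘tabulate (gen ∘ π ∘ suc) i)

relabel-hom : ∀ {d} (π : Fin (suc d) → Fin (suc d)) → Consistent π → IsHom (relabel π)
relabel-hom π consistent u v u~v with InGen⇒gen u~v
... | i , u⊕v≡gᵢ = subst InGen image (gen-InGen (π i))
  where
  image : gen (π i) ≡ relabel π u ⊕ relabel π v
  image = begin
    gen (π i)                  ≡⟨ sym (relabel-gen π consistent i) ⟩
    relabel π (gen i)          ≡⟨ cong (relabel π) (sym u⊕v≡gᵢ) ⟩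
    relabel π (u ⊕ v)          ≡⟨ relabel-⊕ π u v ⟩
    relabel π u ⊕ relabel π v  ∎
    where open ≡-Reasoning

TargetSymmetry : ∀ {d} (ρ ρ′ : Fin (suc d) → Fin (suc d)) → Set
TargetSymmetry ρ ρ′ = Consistent ρ × Consistent ρ′ × (∀ i → ρ′ (ρ (suc i)) ≡ suc i)

symmetry? : ∀ {d} (ρ ρ′ : Fin (suc d) → Fin (suc d)) → Dec (TargetSymmetry ρ ρ′)
symmetry? ρ ρ′ = consistent? ρ ×-dec consistent? ρ′ ×-dec all? (λ i → ρ′ (ρ (suc i)) ≟ᶠ suc i)

module _ {d} (ρ ρ′ : Fin (suc d) → Fin (suc d)) (ρ′-consistent : Consistent ρ′)
         (ρ′-undoes-ρ : ∀ i → ρ′ (ρ (suc i)) ≡ suc i) where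

  -- relabel ρ′ is a left inverse of relabel ρ, because their composite fixes the basis.
  relabel-inverse : ∀ y → relabel ρ′ (relabel ρ y) ≡ y
  relabel-inverse y = begin
    relabel ρ′ (relabel ρ y)                                ≡⟨ linear-compose (tabulate (gen ∘ ρ′ ∘ suc)) (tabulate (gen ∘ ρ ∘ suc)) y ⟩
    linear (map (relabel ρ′) (tabulate (gen ∘ ρ ∘ suc))) y  ≡⟨ cong (λ cs → linear cs y) columns ⟩
    linear (tabulate e) y                                   ≡⟨ linear-basis y ⟩
    y                                                       ∎
    where
    open ≡-Reasoning
    columns : map (relabel ρ′) (tabulate (gen ∘ ρ ∘ suc)) ≡ tabulate e
    columns = trans (sym (tabulate-∘ (relabel ρ′) (gen ∘ ρ ∘ suc)))
                    (tabulate-cong λ i → trans (relabel-gen ρ′ ρ′-consistent (ρ (suc i))) (cong gen (ρ′-undoes-ρ i)))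

  relabel-faithful : ∀ y → relabel ρ y ≡ origin → y ≡ origin
  relabel-faithful y ρy≡0 =
    trans (sym (relabel-inverse y)) (trans (cong (relabel ρ′) ρy≡0) (relabel-origin ρ′))

relabelled-hom : ∀ {m d} {g : Vertex m → Vertex d} (ρ ρ′ : Fin (suc d) → Fin (suc d)) → TargetSymmetry ρ ρ′ →
                IsHom g → Avoids g → IsHom (relabel ρ ∘ g) × Avoids (relabel ρ ∘ g)
relabelled-hom {g = g} ρ ρ′ (ρ-consistent , ρ′-consistent , undoes) g-hom avoids =
  ∘-hom g-hom (relabel-hom ρ ρ-consistent) ,
  λ x ρgx≡0 → avoids x (relabel-faithful ρ ρ′ ρ′-consistent undoes (g x) ρgx≡0)

-- Finite tables indexed by the vertices of PC_n, stored as binary tries.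

data Table (A : Set) : ℕ → Set where
  leaf : A → Table A zero
  node : ∀ {n} → Table A n → Table A n → Table A (suc n)

module _ {A : Set} where

  infixl 9 _!_
  _!_ : ∀ {n} → Table A n → Vertex n → A
  leaf a   ! []          = a
  node l r ! (false ∷ x) = l ! x
  node l r ! (true ∷ x)  = r ! x

  _[_]≔_ : ∀ {n} → Table A n → Vertex n → A → Table A n
  leaf _   [ [] ]≔ a        = leaf a
  node l r [ false ∷ x ]≔ a = node (l [ x ]≔ a) r
  node l r [ true ∷ x ]≔ a  = node l (r [ x ]≔ a)

  constant : ∀ n → A → Table A n
  constant zero    a = leaf a
  constant (suc n) a = node (constant n a) (constant n a)

  zipTable : ∀ {n} → (A → A → A) → Table A n → Table A n → Table A n
  zipTable _∙_ (leaf a)   (leaf b)     = leaf (a ∙ b)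
  zipTable _∙_ (node l r) (node l′ r′) = node (zipTable _∙_ l l′) (zipTable _∙_ r r′)

  shift : ∀ {n} → Table A n → Vertex n → Table A n
  shift (leaf a)   []          = leaf a
  shift (node l r) (false ∷ c) = node (shift l c) (shift r c)
  shift (node l r) (true ∷ c)  = node (shift r c) (shift l c)

  !-≔-same : ∀ {n} (t : Table A n) x a → t [ x ]≔ a ! x ≡ a
  !-≔-same (leaf _)   []          a = refl
  !-≔-same (node l r) (false ∷ x) a = !-≔-same l x a
  !-≔-same (node l r) (true ∷ x)  a = !-≔-same r x a

  !-≔-other : ∀ {n} (t : Table A n) {x y} a → x ≢ y → t [ x ]≔ a ! y ≡ t ! y
  !-≔-other (leaf _)   {[]}        {[]}        a x≢y = ⊥-elim (x≢y refl)
  !-≔-other (node l r) {false ∷ x} {false ∷ y} a x≢y = !-≔-other l a (x≢y ∘ cong (false ∷_))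
  !-≔-other (node l r) {false ∷ x} {true ∷ y}  a _   = refl
  !-≔-other (node l r) {true ∷ x}  {false ∷ y} a _   = refl
  !-≔-other (node l r) {true ∷ x}  {true ∷ y}  a x≢y = !-≔-other r a (x≢y ∘ cong (true ∷_))

  !-constant : ∀ n (a : A) x → constant n a ! x ≡ a
  !-constant zero    a []          = refl
  !-constant (suc n) a (false ∷ x) = !-constant n a x
  !-constant (suc n) a (true ∷ x)  = !-constant n a x

  !-zip : ∀ {n} (_∙_ : A → A → A) (s t : Table A n) x → zipTable _∙_ s t ! x ≡ (s ! x) ∙ (t ! x)
  !-zip _∙_ (leaf a)   (leaf b)     []          = refl
  !-zip _∙_ (node l r) (node l′ r′) (false ∷ x) = !-zip _∙_ l l′ x
  !-zip _∙_ (node l r) (node l′ r′) (true ∷ x)  = !-zip _∙_ r r′ x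

  !-shift : ∀ {n} (t : Table A n) c x → shift t c ! x ≡ t ! (x ⊕ c)
  !-shift (leaf a)   []          []          = refl
  !-shift (node l r) (false ∷ c) (false ∷ x) = !-shift l c x
  !-shift (node l r) (false ∷ c) (true ∷ x)  = !-shift r c x
  !-shift (node l r) (true ∷ c)  (false ∷ x) = !-shift r c x
  !-shift (node l r) (true ∷ c)  (true ∷ x)  = !-shift l c x

VSet : ℕ → Set
VSet = Table Bool

infix 4 _∈ₛ_
_∈ₛ_ : ∀ {n} → Vertex n → VSet n → Set
y ∈ₛ D = T (D ! y)

singleton : ∀ {n} → Vertex n → VSet n
singleton {n} y = constant n false [ y ]≔ true

∈-singleton : ∀ {n} (y : Vertex n) → y ∈ₛ singleton y
∈-singleton {n} y = subst T (sym (!-≔-same (constant n false) y true)) tt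

allExcept : ∀ {n} → List (Vertex n) → VSet n
allExcept {n} = foldr (λ z D → D [ z ]≔ false) (constant n true)

∈-allExcept : ∀ {n} (zs : List (Vertex n)) {y} → ¬ y ∈ zs → y ∈ₛ allExcept zs
∈-allExcept {n} []       {y} _    = subst T (sym (!-constant n true y)) tt
∈-allExcept     (z ∷ zs) {y} y∉zs =
  subst T (sym (!-≔-other (allExcept zs) false (λ z≡y → y∉zs (here (sym z≡y)))))
        (∈-allExcept zs (y∉zs ∘ there))

nonEmpty : ∀ {n} → VSet n → Bool
nonEmpty (leaf b)   = b
nonEmpty (node l r) = nonEmpty l ∨ nonEmpty r

nonEmpty-complete : ∀ {n} (D : VSet n) {y} → y ∈ₛ D → T (nonEmpty D)
nonEmpty-complete (leaf b)   {[]}        y∈D = y∈D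
nonEmpty-complete (node l r) {false ∷ y} y∈D = Equivalence.from T-∨ (inj₁ (nonEmpty-complete l y∈D))
nonEmpty-complete (node l r) {true ∷ y}  y∈D = Equivalence.from T-∨ (inj₂ (nonEmpty-complete r y∈D))

-- Equality and size of sets only steer the search, so they need no correctness proofs.
sameSet : ∀ {n} → VSet n → VSet n → Bool
sameSet (leaf a)   (leaf b)     = a ∧ b ∨ not a ∧ not b
sameSet (node l r) (node l′ r′) = sameSet l l′ ∧ sameSet r r′

size : ∀ {n} → VSet n → ℕ
size (leaf true)  = 1
size (leaf false) = 0
size (node l r)   = size l + size r

every : ∀ {n} → (Vertex n → Bool) → VSet n → Bool
every p (leaf true)  = p []
every p (leaf false) = true
every p (node l r)   = every (p ∘ (false ∷_)) l ∧ every (p ∘ (true ∷_)) r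

every-sound : ∀ {n} (p : Vertex n → Bool) (D : VSet n) {y} → T (every p D) → y ∈ₛ D → T (p y)
every-sound p (leaf true)  {[]}        holds _   = holds
every-sound p (node l r)   {false ∷ y} holds y∈D =
  every-sound (p ∘ (false ∷_)) l (proj₁ (Equivalence.to T-∧ holds)) y∈D
every-sound p (node l r)   {true ∷ y}  holds y∈D =
  every-sound (p ∘ (true ∷_)) r (proj₂ (Equivalence.to (T-∧ {every (p ∘ (false ∷_)) l}) holds)) y∈D

shifts : ∀ {n} → VSet n → List (Vertex n) → VSet n
shifts {n} D []       = constant n false
shifts     D (s ∷ ss) = zipTable _∨_ (shift D s) (shifts D ss)

∈-shifts : ∀ {n} (D : VSet n) {ss s y} → s ∈ ss → y ⊕ s ∈ₛ D → y ∈ₛ shifts D ss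
∈-shifts D {s ∷ ss} {y = y} (here refl) y⊕s∈D =
  subst T (sym (!-zip _∨_ (shift D s) (shifts D ss) y))
        (Equivalence.from T-∨ (inj₁ (subst T (sym (!-shift D s y)) y⊕s∈D)))
∈-shifts D {s′ ∷ ss} {y = y} (there s∈ss) y⊕s∈D =
  subst T (sym (!-zip _∨_ (shift D s′) (shifts D ss) y))
        (Equivalence.from (T-∨ {shift D s′ ! y}) (inj₂ (∈-shifts D s∈ss y⊕s∈D)))

neighbourhood : ∀ {n} → VSet n → VSet n
neighbourhood {n} D = shifts D (generators n)

∈-neighbourhood : ∀ {n} (D : VSet n) {a b} → a ∈ₛ D → Adj a b → b ∈ₛ neighbourhood D
∈-neighbourhood D {a} {b} a∈D a~b = ∈-shifts D (∈-generators a~b) (subst (_∈ₛ D) (sym b⊕[a⊕b]≡a) a∈D)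
  where
  b⊕[a⊕b]≡a : b ⊕ (a ⊕ b) ≡ a
  b⊕[a⊕b]≡a = trans (cong (b ⊕_) (⊕-comm a b)) (⊕-cancelˡ b a)

Succeeds : ∀ {A : Set} → (A → Set) → Maybe A → Set
Succeeds P nothing  = ⊥
Succeeds P (just a) = P a

Succeeds-bind : ∀ {A B : Set} {P : A → Set} {Q : B → Set} (ma : Maybe A) {k : A → Maybe B} →
                Succeeds P ma → (∀ a → P a → Succeeds Q (k a)) → Succeeds Q (ma >>= k)
Succeeds-bind nothing  ()  next
Succeeds-bind (just a) Pa next = next a Pa

-- Refuting homomorphisms PC_m → PC_n with values in prescribed candidate sets.
-- 'propagate' removes candidates without support at some neighbour (arc consistency),
-- 'refute' then branches on the values of a vertex with fewest candidates.

private
  variable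
    m n : ℕ

Domains : ℕ → ℕ → Set
Domains m n = Table (VSet n) m

Queue : ℕ → Set
Queue m = List (Vertex m)

narrowWith : Bool → Bool → Vertex m → VSet n → Queue m × Domains m n → Maybe (Queue m × Domains m n)
narrowWith false _     u D′ _       = nothing
narrowWith true  true  u D′ qS      = just qS
narrowWith true  false u D′ (q , S) = just (u ∷ q , S [ u ]≔ D′)

narrowTo : VSet n → VSet n → Vertex m → Queue m × Domains m n → Maybe (Queue m × Domains m n)
narrowTo D D′ u = narrowWith (nonEmpty D′) (sameSet D D′) u D′

narrow : VSet n → Vertex m → Queue m × Domains m n → Maybe (Queue m × Domains m n)
narrow N u (q , S) = narrowTo (S ! u) (zipTable _∧_ (S ! u) N) u (q , S)

revise : VSet n → Vertex m → List (Vertex m) → Queue m × Domains m n → Maybe (Queue m × Domains m n)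
revise N v []       qS = just qS
revise N v (s ∷ ss) qS = narrow N (v ⊕ s) qS >>= revise N v ss

propagate : ℕ → Queue m × Domains m n → Maybe (Domains m n)
propagate zero    (_ , S)     = just S
propagate (suc k) ([] , S)    = just S
propagate {m = m} (suc k) (v ∷ q , S) = revise (neighbourhood (S ! v)) v (generators m) (q , S) >>= propagate k

choose : Domains m n → Maybe (Vertex m)
choose {m} {n} S = proj₂ (foldl pick (suc (2 ^ n) , nothing) (vertices m))
  where
  pickBy : ℕ → ℕ × Maybe (Vertex m) → Vertex m → ℕ × Maybe (Vertex m)
  pickBy k (best , r) x = if (1 <ᵇ k) ∧ (k <ᵇ best) then (k , just x) else (best , r)
  pick : ℕ × Maybe (Vertex m) → Vertex m → ℕ × Maybe (Vertex m)
  pick acc x = pickBy (size (S ! x)) acc x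

-- Stopping propagation early is still sound; the bound only keeps 'propagate' structural.
propagationFuel : ℕ
propagationFuel = 1000000

mutual
  refute : ℕ → Queue m → Domains m n → Bool
  refute zero    q S = false
  refute (suc k) q S = refuteFixpoint k (propagate propagationFuel (q , S))

  refuteFixpoint : ℕ → Maybe (Domains m n) → Bool
  refuteFixpoint k nothing  = true
  refuteFixpoint k (just S) = branch k S (choose S)

  branch : ℕ → Domains m n → Maybe (Vertex m) → Bool
  branch k S nothing  = false
  branch k S (just x) = every (λ y → refute k (x ∷ []) (S [ x ]≔ singleton y)) (S ! x)

module Soundness {m n : ℕ} (f : Vertex m → Vertex n) (f-hom : IsHom f) where

  Admits : Domains m n → Set
  Admits S = ∀ x → f x ∈ₛ S ! x

  admits-≔ : ∀ S u D → Admits S → f u ∈ₛ D → Admits (S [ u ]≔ D)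
  admits-≔ S u D admits fu∈D x with u ≟ᵥ x
  ... | yes refl = subst (f u ∈ₛ_) (sym (!-≔-same S u D)) fu∈D
  ... | no  u≢x  = subst (f x ∈ₛ_) (sym (!-≔-other S D u≢x)) (admits x)

  narrowWith-sound : ∀ b c u D′ q S → nonEmpty D′ ≡ b → Admits S → f u ∈ₛ D′ →
                     Succeeds (Admits ∘ proj₂) (narrowWith b c u D′ (q , S))
  narrowWith-sound false _     u D′ q S empty _      fu∈D′ = subst T empty (nonEmpty-complete D′ fu∈D′)
  narrowWith-sound true  true  u D′ q S _     admits _     = admits
  narrowWith-sound true  false u D′ q S _     admits fu∈D′ = admits-≔ S u D′ admits fu∈D′

  narrow-sound : ∀ N u q S → Admits S → f u ∈ₛ N → Succeeds (Admits ∘ proj₂) (narrow N u (q , S))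
  narrow-sound N u q S admits fu∈N = narrowWith-sound _ _ u D′ q S refl admits fu∈D′
    where
    D′ = zipTable _∧_ (S ! u) N
    fu∈D′ : f u ∈ₛ D′
    fu∈D′ = subst T (sym (!-zip _∧_ (S ! u) N (f u))) (Equivalence.from T-∧ (admits u , fu∈N))

  Covers : VSet n → Vertex m → Set
  Covers N v = ∀ u → Adj v u → f u ∈ₛ N

  revise-sound : ∀ N v ss q S → (∀ {s} → s ∈ ss → InGen s) → Covers N v → Admits S →
                 Succeeds (Admits ∘ proj₂) (revise N v ss (q , S))
  revise-sound N v []       q S _     _      admits = admits
  revise-sound N v (s ∷ ss) q S gens covers admits =
    Succeeds-bind (narrow N (v ⊕ s) (q , S))
      (narrow-sound N (v ⊕ s) q S admits (covers (v ⊕ s) (Adj-step v (gens (here refl)))))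
      (λ (q′ , S′) → revise-sound N v ss q′ S′ (gens ∘ there) covers)

  propagate-sound : ∀ k q S → Admits S → Succeeds Admits (propagate k (q , S))
  propagate-sound zero    q       S admits = admits
  propagate-sound (suc k) []      S admits = admits
  propagate-sound (suc k) (v ∷ q) S admits =
    Succeeds-bind (revise N v (generators m) (q , S))
      (revise-sound N v (generators m) q S generators-InGen covers admits)
      (λ (q′ , S′) → propagate-sound k q′ S′)
    where
    N = neighbourhood (S ! v)
    covers : Covers N v
    covers u v~u = ∈-neighbourhood (S ! v) (admits v) (f-hom v u v~u)

  -- The search cannot succeed while f is admitted: the branch for the value of f at
  -- the chosen vertex is itself admitted.
  mutual
    refute-sound : ∀ k q S → Admits S → refute k q S ≢ true
    refute-sound zero    q S admits ()
    refute-sound (suc k) q S admits =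
      refuteFixpoint-sound k (propagate propagationFuel (q , S)) (propagate-sound propagationFuel q S admits)

    refuteFixpoint-sound : ∀ k mS → Succeeds Admits mS → refuteFixpoint k mS ≢ true
    refuteFixpoint-sound k nothing  ()
    refuteFixpoint-sound k (just S) admits = branch-sound k S (choose S) admits

    branch-sound : ∀ k S mx → Admits S → branch k S mx ≢ true
    branch-sound k S nothing  admits ()
    branch-sound k S (just x) admits holds =
      refute-sound k (x ∷ []) (S [ x ]≔ singleton (f x))
        (admits-≔ S x (singleton (f x)) admits (∈-singleton (f x)))
        (Equivalence.to T-≡ (every-sound _ (S ! x) (Equivalence.from T-≡ holds) (admits x)))

-- From here on: homomorphisms PC₆ → PC₄.  The base point of PC₄ is the generator J;
-- its neighbours other than 0 are base ⊕ gen (suc k) for the four labels k : Fin 4.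

base : Vertex 4
base = gen zero

-- A pattern records the labels of the images of the seven generators of PC₆.
Pattern : Set
Pattern = Vec (Fin 4) 7

Follows : (Vertex 6 → Vertex 4) → Pattern → Set
Follows g n = g origin ≡ base × ∀ j → g (gen j) ≡ base ⊕ gen (suc (lookup n j))

-- Up to permuting positions and labels, a pattern is determined by the partition of 7
-- given by its label multiplicities.
partition : ∀ a b c d → Vec (Fin 4) (a + (b + (c + d)))
partition a b c d = replicate a (# 0) ++ replicate b (# 1) ++ replicate c (# 2) ++ replicate d (# 3)

canonicalPatterns : List Pattern
canonicalPatterns =
  partition 7 0 0 0 ∷ partition 6 1 0 0 ∷ partition 5 2 0 0 ∷ partition 5 1 1 0 ∷
  partition 4 3 0 0 ∷ partition 4 2 1 0 ∷ partition 4 1 1 1 ∷ partition 3 3 1 0 ∷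
  partition 3 2 2 0 ∷ partition 3 2 1 1 ∷ partition 2 2 2 1 ∷ []

baseDomains : Domains 6 4
baseDomains = constant 6 (allExcept (origin ∷ [])) [ origin ]≔ singleton base

pinNeighbour : Pattern → Fin 7 → Domains 6 4 → Domains 6 4
pinNeighbour p j S = S [ gen j ]≔ singleton (base ⊕ gen (suc (lookup p j)))

patternDomains : Pattern → Domains 6 4
patternDomains p = foldr (pinNeighbour p) baseDomains (allFin 7)

patternDomains-admitted : ∀ {g} (g-hom : IsHom g) → Avoids g → ∀ {p} → Follows g p →
                          Soundness.Admits g g-hom (patternDomains p)
patternDomains-admitted {g} g-hom avoids {p} (at-origin , at-generators) = pinned (allFin 7)
  where
  open Soundness g g-hom
  nonzero : Admits (constant 6 (allExcept (origin ∷ [])))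
  nonzero x = subst (g x ∈ₛ_) (sym (!-constant 6 _ x))
                    (∈-allExcept (origin ∷ []) λ { (here gx≡0) → avoids x gx≡0 ; (there ()) })
  pinned : ∀ js → Admits (foldr (pinNeighbour p) baseDomains js)
  pinned []       = admits-≔ (constant 6 (allExcept (origin ∷ []))) origin (singleton base) nonzero
                      (subst (_∈ₛ singleton base) (sym at-origin) (∈-singleton base))
  pinned (j ∷ js) = admits-≔ (foldr (pinNeighbour p) baseDomains js) (gen j) (singleton yⱼ) (pinned js)
                      (subst (_∈ₛ singleton yⱼ) (sym (at-generators j)) (∈-singleton yⱼ))
    where yⱼ = base ⊕ gen (suc (lookup p j))

canonicalPatterns-refuted : All (λ p → refute 2000 (origin ∷ generators 6) (patternDomains p) ≡ true) canonicalPatterns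
canonicalPatterns-refuted = refl ∷ refl ∷ refl ∷ refl ∷ refl ∷ refl ∷ refl ∷ refl ∷ refl ∷ refl ∷ refl ∷ []

no-hom-following-canonical : ∀ {g p} → p ∈ canonicalPatterns → IsHom g → Avoids g → Follows g p → ⊥
no-hom-following-canonical {g} {p} canonical g-hom avoids follows =
  Soundness.refute-sound g g-hom 2000 (origin ∷ generators 6) (patternDomains p)
    (patternDomains-admitted g-hom avoids {p} follows) (All.lookup canonicalPatterns-refuted canonical)

-- A candidate consists of a
-- permutation π of the generators of PC₆ and a permutation σ (with inverse τ) of the
-- labels; 'candidate' computes one by ranking labels by multiplicity and sorting the
-- positions by rank, and 'every-pattern-reduces' checks it for all 4⁷ patterns.

Candidate : Set
Candidate = Vec (Fin 7) 7 × Vec (Fin 4) 4 × Vec (Fin 4) 4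

Reduces : Pattern → Candidate → Set
Reduces n (π , σ , τ) =
  Consistent (lookup π) × TargetSymmetry (lift 1 (lookup σ)) (lift 1 (lookup τ)) ×
  tabulate (lookup σ ∘ lookup n ∘ lookup π) ∈ canonicalPatterns

reduces? : ∀ n c → Dec (Reduces n c)
reduces? n (π , σ , τ) =
  consistent? (lookup π) ×-dec symmetry? (lift 1 (lookup σ)) (lift 1 (lookup τ)) ×-dec
  tabulate (lookup σ ∘ lookup n ∘ lookup π) ∈? canonicalPatterns

labelCounts : Pattern → Vec ℕ 4
labelCounts n = tabulate (λ k → count (_≟ᶠ k) n)

rankedBefore : Vec ℕ 4 → Fin 4 → Fin 4 → Bool
rankedBefore c k′ k = (lookup c k <ᵇ lookup c k′) ∨ ((lookup c k′ ≡ᵇ lookup c k) ∧ (toℕ k′ <ᵇ toℕ k))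

clamp : ∀ {k} → ℕ → Fin (suc k)
clamp {k}     zero    = zero
clamp {zero}  (suc _) = zero
clamp {suc k} (suc i) = suc (clamp i)

-- σ sends each label to its rank.  These helpers need no proofs: 'reduces?' checks
-- the candidate they produce.
ranking : Vec ℕ 4 → Vec (Fin 4) 4
ranking c = tabulate (λ k → clamp (length (filterᵇ (λ k′ → rankedBefore c k′ k) (allFin 4))))

invert : ∀ {k} → Vec (Fin k) k → Vec (Fin k) k
invert {k} σ = tabulate (λ r → foldr (λ i other → if ⌊ lookup σ i ≟ᶠ r ⌋ then i else other) r (allFin k))

padTo : ∀ {A : Set} → A → List A → ∀ k → Vec A k
padTo a xs       zero    = []
padTo a []       (suc k) = a ∷ padTo a [] k
padTo a (x ∷ xs) (suc k) = x ∷ padTo a xs k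

sortedPositions : Pattern → Vec (Fin 4) 4 → Vec (Fin 7) 7
sortedPositions n σ =
  padTo zero (concatMap (λ r → filterᵇ (λ j → ⌊ lookup σ (lookup n j) ≟ᶠ r ⌋) (allFin 7)) (allFin 4)) 7

candidateFrom : Pattern → Vec (Fin 4) 4 → Candidate
candidateFrom n σ = sortedPositions n σ , σ , invert σ

-- Opaque, so that reasoning about a symbolic pattern never unfolds the computation.
opaque
  candidate : Pattern → Candidate
  candidate n = candidateFrom n (ranking (labelCounts n))

opaque
  unfolding candidate
  every-pattern-reduces : all (λ n → ⌊ reduces? n (candidate n) ⌋) (vectors (allFin 4) 7) ≡ true
  every-pattern-reduces = refl

reduction : ∀ n → Reduces n (candidate n)
reduction n = toWitness {a? = reduces? n (candidate n)} (Equivalence.from T-≡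
  (all-sound (λ n → ⌊ reduces? n (candidate n) ⌋) every-pattern-reduces (∈-vectors ∈-allFin n)))

no-hom-following-reduced : ∀ {g} n c → Reduces n c → IsHom g → Avoids g → Follows g n → ⊥
no-hom-following-reduced {g} n (π , σ , τ) (π-consistent , symmetric@(σ-consistent , _) , canonical)
                         g-hom avoids (at-origin , at-generators) =
  no-hom-following-canonical canonical (proj₁ reduced) (proj₂ reduced) (at-origin′ , at-generators′)
  where
  open ≡-Reasoning
  σ↑ = lift 1 (lookup σ)
  reduced = relabelled-hom σ↑ (lift 1 (lookup τ)) symmetric (∘-hom (relabel-hom (lookup π) π-consistent) g-hom) (avoids ∘ relabel (lookup π))
  at-origin′ : relabel σ↑ (g (relabel (lookup π) origin)) ≡ base
  at-origin′ = begin
    relabel σ↑ (g (relabel (lookup π) origin))  ≡⟨ cong (relabel σ↑ ∘ g) (relabel-origin (lookup π)) ⟩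
    relabel σ↑ (g origin)                       ≡⟨ cong (relabel σ↑) at-origin ⟩
    relabel σ↑ base                             ≡⟨ relabel-gen σ↑ σ-consistent zero ⟩
    base                                        ∎
  at-generators′ : ∀ j → relabel σ↑ (g (relabel (lookup π) (gen j))) ≡
                         base ⊕ gen (suc (lookup (tabulate (lookup σ ∘ lookup n ∘ lookup π)) j))
  at-generators′ j = begin
    relabel σ↑ (g (relabel (lookup π) (gen j)))  ≡⟨ cong (relabel σ↑ ∘ g) (relabel-gen (lookup π) π-consistent j) ⟩
    relabel σ↑ (g (gen (lookup π j)))            ≡⟨ cong (relabel σ↑) (at-generators (lookup π j)) ⟩
    relabel σ↑ (base ⊕ gen (suc k))              ≡⟨ relabel-⊕ σ↑ base (gen (suc k)) ⟩
    relabel σ↑ base ⊕ relabel σ↑ (gen (suc k))   ≡⟨ cong₂ _⊕_ (relabel-gen σ↑ σ-consistent zero) (relabel-gen σ↑ σ-consistent (suc k)) ⟩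
    base ⊕ gen (suc (lookup σ k))                ≡⟨ cong (λ l → base ⊕ gen (suc l)) (sym (lookup∘tabulate (lookup σ ∘ lookup n ∘ lookup π) j)) ⟩
    base ⊕ gen (suc (lookup (tabulate (lookup σ ∘ lookup n ∘ lookup π)) j))  ∎
    where k = lookup n (lookup π j)

neighbour-label : ∀ {y} → Adj base y → y ≢ origin → ∃[ k ] y ≡ base ⊕ gen (suc k)
neighbour-label base~y y≢0 with Adj⇒gen base~y
... | zero  , y≡base⊕base = ⊥-elim (y≢0 (trans y≡base⊕base (⊕-self base)))
... | suc k , y≡base⊕gₖ   = k , y≡base⊕gₖ

no-hom-through-base : ∀ {g} → IsHom g → Avoids g → g origin ≡ base → ⊥
no-hom-through-base {g} g-hom avoids at-origin =
  no-hom-following-reduced labels (candidate labels) (reduction labels) g-hom avoids (at-origin , follows)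
  where
  label : ∀ j → ∃[ k ] g (gen j) ≡ base ⊕ gen (suc k)
  label j = neighbour-label (subst (λ b → Adj b (g (gen j))) at-origin (g-hom origin (gen j) origin~gⱼ)) (avoids (gen j))
    where
    origin~gⱼ : Adj origin (gen j)
    origin~gⱼ = subst (Adj origin) (⊕-identityˡ (gen j)) (Adj-step origin (gen-InGen j))
  labels : Pattern
  labels = tabulate (proj₁ ∘ label)
  follows : ∀ j → g (gen j) ≡ base ⊕ gen (suc (lookup labels j))
  follows j = trans (proj₂ (label j)) (cong (λ k → base ⊕ gen (suc k)) (sym (lookup∘tabulate (proj₁ ∘ label) j)))

petersenDomains : Domains 6 4
petersenDomains = constant 6 (allExcept (origin ∷ generators 4))

petersenDomains-refuted : refute 2000 (vertices 6) petersenDomains ≡ true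
petersenDomains-refuted = refl

no-hom-missing-neighbours : ∀ {g} → IsHom g → Avoids g → (∀ x → ¬ InGen (g x)) → ⊥
no-hom-missing-neighbours {g} g-hom avoids none =
  refute-sound 2000 (vertices 6) petersenDomains admits petersenDomains-refuted
  where
  open Soundness g g-hom
  admits : Admits petersenDomains
  admits x = subst (g x ∈ₛ_) (sym (!-constant 6 _ x)) (∈-allExcept (origin ∷ generators 4) excluded)
    where
    excluded : ¬ g x ∈ origin ∷ generators 4
    excluded (here gx≡0)  = avoids x gx≡0
    excluded (there gx∈S) = none x (generators-InGen gx∈S)

toBase : Fin 5 → Fin 5 → Fin 5
toBase i = transpose zero i

toBase-symmetric : ∀ i → TargetSymmetry (toBase i) (toBase i) × toBase i i ≡ zero
toBase-symmetric = toWitness {a? = all? (λ i → symmetry? (toBase i) (toBase i) ×-dec toBase i i ≟ᶠ zero)} tt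

no-hom-avoiding-origin : ∀ {g} → IsHom g → Avoids g → ⊥
no-hom-avoiding-origin {g} g-hom avoids with witnessOrNone (InGen? ∘ g)
... | inj₂ none = no-hom-missing-neighbours g-hom avoids none
... | inj₁ (u , gu∈S) with InGen⇒gen gu∈S
...   | i , gu≡gᵢ = no-hom-through-base (proj₁ moved) (proj₂ moved) at-base
  where
  open ≡-Reasoning
  swap = toBase i
  moved = relabelled-hom swap swap (proj₁ (toBase-symmetric i)) (∘-hom (translation-hom u) g-hom) (avoids ∘ (_⊕ u))
  at-base : relabel swap (g (origin ⊕ u)) ≡ base
  at-base = begin
    relabel swap (g (origin ⊕ u))  ≡⟨ cong (relabel swap ∘ g) (⊕-identityˡ u) ⟩
    relabel swap (g u)             ≡⟨ cong (relabel swap) gu≡gᵢ ⟩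
    relabel swap (gen i)           ≡⟨ relabel-gen swap (proj₁ (proj₁ (toBase-symmetric i))) i ⟩
    gen (swap i)                   ≡⟨ cong gen (proj₂ (toBase-symmetric i)) ⟩
    base                           ∎

-- If f missed w, then x ↦ f x ⊕ w would be a homomorphism avoiding 0.
theorem15 : (f : Vertex 6 → Vertex 4) → IsHom f → Surjective f
theorem15 f f-hom w with witnessOrNone (λ u → f u ≟ᵥ w)
... | inj₁ hit  = hit
... | inj₂ miss = ⊥-elim (no-hom-avoiding-origin (∘-hom f-hom (translation-hom w))
                            (λ x fx⊕w≡0 → miss x (⊕-equal (f x) w fx⊕w≡0)))
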